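{- A graph $G$ is a proper veto interval (PVI) graph if and only if $G$ is a unit veto interval (UVI) graph.
   Context: All graphs are finite. A veto interval is a triple $I(a)=(a_l,a_v,a_r)$ of reals with $a_l<a_v<a_r$. A veto interval representation of a graph $G$ assigns to each vertex $a$ a veto interval $I(a)$ such that distinct vertices $a,b$ are adjacent if and only if $a_v<b_l<a_r<b_v$ or $b_v<a_l<b_r<a_v$. It is unit if all intervals $[a_l,a_r]$ have the same length, and proper if no interval properly contains another. PVI (resp. UVI) graphs are graphs with a proper (resp. unit) veto interval representation.
   Formalization: The veto intervals are triples of rationals rather than of reals, in both proper and unit veto interval representations. -}

module Defs where

open import Data.Nat using (ℕ)
open import Data.Fin using (Fin)
open import Data.Rational using (ℚ; _<_; _≤_; _-_)
open import Data.Product using (_×_; ∃)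
open import Data.Sum using (_⊎_)
open import Relation.Nullary using (¬_)
open import Relation.Binary.PropositionalEquality using (_≡_; _≢_)
open import Function.Bundles using (_⇔_)
open import Level using (0ℓ)

record Graph : Set₁ where
  field
    n     : ℕ
    Adj   : Fin n → Fin n → Set
    sym   : ∀ {a b} → Adj a b → Adj b a
    irrefl : ∀ {a} → ¬ Adj a a

record VetoInterval : Set where
  constructor vi
  field
    l v r : ℚ
    l<v   : l < v
    v<r   : v < r

open VetoInterval public

VetoAdj : VetoInterval → VetoInterval → Set
VetoAdj a b = (v a < l b × l b < r a × r a < v b)
            ⊎ (v b < l a × l a < r b × r b < v a)

IsVIRep : (G : Graph) → (Fin (Graph.n G) → VetoInterval) → Set
IsVIRep G I = ∀ a b → a ≢ b → (Graph.Adj G a b ⇔ VetoAdj (I a) (I b))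

ProperlyContains : VetoInterval → VetoInterval → Set
ProperlyContains a b = l a ≤ l b × r b ≤ r a × (l a < l b ⊎ r b < r a)

IsProper : ∀ {n} → (Fin n → VetoInterval) → Set
IsProper I = ∀ a b → ¬ ProperlyContains (I a) (I b)

IsUnit : ∀ {n} → (Fin n → VetoInterval) → Set
IsUnit I = ∃ λ L → ∀ a → r (I a) - l (I a) ≡ L

PVI : Graph → Set
PVI G = ∃ λ I → IsVIRep G I × IsProper I

UVI : Graph → Set
UVI G = ∃ λ I → IsVIRep G I × IsUnit I

{-# OPTIONS --safe #-}
-- In a proper representation, left and right endpoints are ordered alike. This allows building
-- a strictly increasing ψ : ℚ → ℚ with ψ (r a) - ψ (l a) = 1 for every interval, from right to
-- left: once ψ gives length 1 to the intervals starting strictly right of the leftmost one s,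
-- redefine ψ affinely below the first endpoint they use (or r s) so that s gets length 1 too.
-- Applying ψ to all three coordinates of each veto interval preserves every comparison, hence
-- the graph. Conversely, intervals of equal length never properly contain one another.
module Submission where

open import Data.Fin using (Fin)
open import Data.List using (List; []; _∷_; filter; length; map; allFin)
open import Data.List.Properties using (filter-notAll)
import Data.List.Extrema
open import Data.List.Membership.Propositional using (_∈_)
open import Data.List.Membership.Propositional.Properties
  using (∈-filter⁺; ∈-filter⁻; ∈-map⁺; ∈-allFin)
open import Data.List.Relation.Unary.All as All using ()
open import Data.List.Relation.Unary.All.Properties as All using ()
open import Data.List.Relation.Unary.Any as Any using (here; there)
import Data.Nat as ℕ
open import Data.Nat.Induction using (<-wellFounded)
open import Data.Product using (_×_; _,_; proj₁; proj₂; ∃-syntax)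
open import Data.Rational
  using (ℚ; _<_; _≤_; _-_; _*_; -_; 1/_; 0ℚ; 1ℚ; _≤?_; _<?_; positive)
open import Data.Rational.Properties
open import Data.Rational.Solver using (module +-*-Solver)
open import Data.Sum using (inj₁; inj₂; [_,_]′)
open import Function using (_∘_; _on_; case_of_)
open import Function.Bundles using (_⇔_; mk⇔)
open import Function.Construct.Composition using (_⇔-∘_)
open import Induction.WellFounded using (Acc; acc)
open import Relation.Binary.Bundles using (DecTotalOrder)
open import Relation.Binary.Core using (_Preserves_⟶_)
import Relation.Binary.Construct.On as On
open import Relation.Binary.Definitions using (tri<; tri≈; tri>)
open import Relation.Binary.PropositionalEquality
open import Relation.Nullary using (¬_; yes; no; contradiction)

open import Defs

open +-*-Solver

<⇒0<- : ∀ {p q} → p < q → 0ℚ < q - p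
<⇒0<- {p} {q} p<q = subst (_< q - p) (+-inverseʳ p) (+-monoˡ-< (- p) p<q)

0<-⇒< : ∀ {p q} → 0ℚ < q - p → p < q
0<-⇒< {p} {q} 0<q-p = subst₂ _<_ (+-identityˡ p) (solve 2 (λ p q → (q :- p) :+ p := q) refl p q)
  (+-monoˡ-< p 0<q-p)

p-q<p : ∀ p {q} → 0ℚ < q → p - q < p
p-q<p p {q} 0<q = 0<-⇒< (subst (0ℚ <_) (solve 2 (λ p q → q := p :- (p :- q)) refl p q) 0<q)

p-q≡r⇒p-r≡q : ∀ p q {r} → p - q ≡ r → p - r ≡ q
p-q≡r⇒p-r≡q p q refl = solve 2 (λ p q → p :- (p :- q) := q) refl p q

<⇒≱ : ∀ {p q} → p < q → ¬ q ≤ p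
<⇒≱ p<q q≤p = <-irrefl refl (<-≤-trans p<q q≤p)

*-positive : ∀ {p q} → 0ℚ < p → 0ℚ < q → 0ℚ < p * q
*-positive {p} {q} 0<p 0<q =
  positive⁻¹ (p * q) {{pos*pos⇒pos p {{positive 0<p}} q {{positive 0<q}}}}

positive-quotient : ∀ {p q} → 0ℚ < p → 0ℚ < q → ∃[ k ] 0ℚ < k × q * k ≡ p
positive-quotient {p} {q} 0<p 0<q = p * 1/q , *-positive 0<p 0<1/q , q*[p*1/q]≡p
  where
  instance
    q-pos = positive 0<q
    q≢0 = pos⇒nonZero q
  1/q = 1/ q
  0<1/q : 0ℚ < 1/q
  0<1/q = positive⁻¹ 1/q {{1/pos⇒pos q}}
  q*[p*1/q]≡p : q * (p * 1/q) ≡ p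
  q*[p*1/q]≡p = begin
    q * (p * 1/q) ≡⟨ sym (*-assoc q p 1/q) ⟩
    q * p * 1/q   ≡⟨ cong (_* 1/q) (*-comm q p) ⟩
    p * q * 1/q   ≡⟨ *-assoc p q 1/q ⟩
    p * (q * 1/q) ≡⟨ cong (p *_) (*-inverseʳ q) ⟩
    p * 1ℚ        ≡⟨ *-identityʳ p ⟩
    p             ∎
    where open ≡-Reasoning

StrictlyIncreasing : (ℚ → ℚ) → Set
StrictlyIncreasing ψ = ψ Preserves _<_ ⟶ _<_

module _ {ψ : ℚ → ℚ} (ψ-mono : StrictlyIncreasing ψ) where

  strictlyIncreasing⇒mono-≤ : ψ Preserves _≤_ ⟶ _≤_
  strictlyIncreasing⇒mono-≤ {x} {y} x≤y with <-cmp x y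
  ... | tri< x<y _ _ = <⇒≤ (ψ-mono x<y)
  ... | tri≈ _ refl _ = ≤-refl
  ... | tri> _ _ y<x = contradiction x≤y (<⇒≱ y<x)

  strictlyIncreasing-cancel-< : ∀ {x y} → ψ x < ψ y → x < y
  strictlyIncreasing-cancel-< {x} {y} ψx<ψy with x <? y
  ... | yes x<y = x<y
  ... | no x≮y = contradiction (strictlyIncreasing⇒mono-≤ (≮⇒≥ x≮y)) (<⇒≱ ψx<ψy)

extendBelow : (ℚ → ℚ) → (m k : ℚ) → ℚ → ℚ
extendBelow ψ m k x with m ≤? x
... | yes _ = ψ x
... | no  _ = ψ m - (m - x) * k

module _ (ψ : ℚ → ℚ) (m k : ℚ) where

  extendBelow-≥ : ∀ {x} → m ≤ x → extendBelow ψ m k x ≡ ψ x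
  extendBelow-≥ {x} m≤x with m ≤? x
  ... | yes _ = refl
  ... | no m≰x = contradiction m≤x m≰x

  extendBelow-< : ∀ {x} → x < m → extendBelow ψ m k x ≡ ψ m - (m - x) * k
  extendBelow-< {x} x<m with m ≤? x
  ... | yes m≤x = contradiction m≤x (<⇒≱ x<m)
  ... | no _ = refl

  extendBelow-strictlyIncreasing : StrictlyIncreasing ψ → 0ℚ < k →
                                   StrictlyIncreasing (extendBelow ψ m k)
  extendBelow-strictlyIncreasing ψ-mono 0<k {x} {y} x<y with m ≤? x | m ≤? y
  ... | yes _   | yes _   = ψ-mono x<y
  ... | yes m≤x | no m≰y  = contradiction (≤-trans m≤x (<⇒≤ x<y)) m≰y
  ... | no m≰x  | yes m≤y = <-≤-trans (p-q<p (ψ m) (*-positive (<⇒0<- (≰⇒> m≰x)) 0<k))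
                                      (strictlyIncreasing⇒mono-≤ ψ-mono m≤y)
  ... | no _    | no _    = +-monoʳ-< (ψ m) (neg-antimono-< (*-monoˡ-<-pos k {{positive 0<k}}
                              (+-monoʳ-< m (neg-antimono-< x<y))))

stretchBelow : ∀ {ψ} → StrictlyIncreasing ψ → ∀ {l m h} → l < m → m ≤ h → ψ h - 1ℚ < ψ m →
               ∃[ φ ] StrictlyIncreasing φ × (∀ {x} → m ≤ x → φ x ≡ ψ x) × φ h - φ l ≡ 1ℚ
stretchBelow {ψ} ψ-mono {l} {m} {h} l<m m≤h ψh-1<ψm =
  φ , extendBelow-strictlyIncreasing ψ m k ψ-mono 0<k , extendBelow-≥ ψ m k , φh-φl≡1
  where
  slope = positive-quotient (<⇒0<- ψh-1<ψm) (<⇒0<- l<m)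
  k = proj₁ slope
  0<k = proj₁ (proj₂ slope)
  φ = extendBelow ψ m k
  φh-φl≡1 : φ h - φ l ≡ 1ℚ
  φh-φl≡1 = begin
    φ h - φ l                        ≡⟨ cong₂ _-_ (extendBelow-≥ ψ m k m≤h) (extendBelow-< ψ m k l<m) ⟩
    ψ h - (ψ m - (m - l) * k)        ≡⟨ cong (λ d → ψ h - (ψ m - d)) (proj₂ (proj₂ slope)) ⟩
    ψ h - (ψ m - (ψ m - (ψ h - 1ℚ))) ≡⟨ solve 2 (λ a b → a :- (b :- (b :- (a :- con 1ℚ))) := con 1ℚ)
                                                refl (ψ h) (ψ m) ⟩
    1ℚ                               ∎
    where open ≡-Reasoning

module UnitRescaling {A : Set} (lo hi : A → ℚ)
  (lo<hi : ∀ a → lo a < hi a)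
  (lo<⇒hi< : ∀ {a b} → lo a < lo b → hi a < hi b)
  (lo≡⇒hi≡ : ∀ {a b} → lo a ≡ lo b → hi a ≡ hi b) where

  open Data.List.Extrema (DecTotalOrder.totalOrder ≤-decTotalOrder)

  HasUnitLengths : (ℚ → ℚ) → List A → Set
  HasUnitLengths ψ as = ∀ {a} → a ∈ as → ψ (hi a) - ψ (lo a) ≡ 1ℚ

  HasUnitRescaling : List A → Set
  HasUnitRescaling as = ∃[ ψ ] StrictlyIncreasing ψ × HasUnitLengths ψ as

  above : A → List A → List A
  above s = filter (λ a → lo s <? lo a)

  above-shorter : ∀ {s as} → s ∈ as → length (above s as) ℕ.< length as
  above-shorter {s} {as} s∈as =
    filter-notAll (λ a → lo s <? lo a) as (Any.map (λ { refl → <-irrefl refl }) s∈as)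

  above⁺ : ∀ {s a as} → a ∈ as → lo s < lo a → a ∈ above s as
  above⁺ {s} = ∈-filter⁺ (λ a → lo s <? lo a)

  above⁻ : ∀ {s a as} → a ∈ above s as → lo s < lo a
  above⁻ {s} {as = as} a∈ = proj₂ (∈-filter⁻ (λ a → lo s <? lo a) {xs = as} a∈)

  -- m lies below every endpoint of the intervals above s, so ψ may be changed freely below m;
  -- Admissible m holds because hi s < hi b gives ψ (hi s) - 1 < ψ (hi b) - 1 = ψ (lo b).
  rescaleLeftmost : ∀ {s as} → (∀ {a} → a ∈ as → lo s ≤ lo a) →
                    HasUnitRescaling (above s as) → HasUnitRescaling as
  rescaleLeftmost {s} {as} s-leftmost (ψ , ψ-mono , ψ-unit) = φ , φ-mono , φ-unit
    where
    m = min (hi s) (map lo (above s as))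

    m≤lo : ∀ {a} → a ∈ above s as → m ≤ lo a
    m≤lo a∈ = All.lookup (min≤xs (hi s) (map lo (above s as))) (∈-map⁺ lo a∈)

    Admissible : ℚ → Set
    Admissible x = lo s < x × ψ (hi s) - 1ℚ < ψ x

    admissible-lo : ∀ {a} → a ∈ above s as → Admissible (lo a)
    admissible-lo {a} a∈ = lo-s<lo-a ,
      subst (ψ (hi s) - 1ℚ <_) (p-q≡r⇒p-r≡q (ψ (hi a)) (ψ (lo a)) (ψ-unit a∈))
            (+-monoˡ-< (- 1ℚ) (ψ-mono (lo<⇒hi< lo-s<lo-a)))
      where lo-s<lo-a = above⁻ {s} {as = as} a∈

    m-admissible : Admissible m
    m-admissible = argmin-all (λ x → x) {P = Admissible}
                     (lo<hi s , p-q<p (ψ (hi s)) (positive⁻¹ 1ℚ))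
                     (All.map⁺ (All.tabulate admissible-lo))

    φ-stretch : ∃[ φ ] StrictlyIncreasing φ × (∀ {x} → m ≤ x → φ x ≡ ψ x) ×
                       φ (hi s) - φ (lo s) ≡ 1ℚ
    φ-stretch = stretchBelow ψ-mono (proj₁ m-admissible) (min≤⊤ (hi s) (map lo (above s as)))
                             (proj₂ m-admissible)

    φ : ℚ → ℚ
    φ = proj₁ φ-stretch

    φ-mono : StrictlyIncreasing φ
    φ-mono = proj₁ (proj₂ φ-stretch)

    φ≡ψ : ∀ {x} → m ≤ x → φ x ≡ ψ x
    φ≡ψ = proj₁ (proj₂ (proj₂ φ-stretch))

    φ-unit-above : ∀ {a} → a ∈ above s as → φ (hi a) - φ (lo a) ≡ 1ℚ
    φ-unit-above {a} a∈ = begin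
      φ (hi a) - φ (lo a) ≡⟨ cong₂ _-_ (φ≡ψ (≤-trans (m≤lo a∈) (<⇒≤ (lo<hi a))))
                                       (φ≡ψ (m≤lo a∈)) ⟩
      ψ (hi a) - ψ (lo a) ≡⟨ ψ-unit a∈ ⟩
      1ℚ                  ∎
      where open ≡-Reasoning

    φ-unit-level : ∀ {a} → lo a ≡ lo s → φ (hi a) - φ (lo a) ≡ 1ℚ
    φ-unit-level {a} lo-a≡lo-s = begin
      φ (hi a) - φ (lo a) ≡⟨ cong₂ (λ x y → φ x - φ y) (lo≡⇒hi≡ lo-a≡lo-s) lo-a≡lo-s ⟩
      φ (hi s) - φ (lo s) ≡⟨ proj₂ (proj₂ (proj₂ φ-stretch)) ⟩
      1ℚ                  ∎
      where open ≡-Reasoning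

    φ-unit : HasUnitLengths φ as
    φ-unit {a} a∈ = case lo s <? lo a of λ where
      (yes lo-s<lo-a) → φ-unit-above (above⁺ {s} a∈ lo-s<lo-a)
      (no lo-s≮lo-a)  → φ-unit-level (≤-antisym (≮⇒≥ lo-s≮lo-a) (s-leftmost a∈))

  unitRescaling : (as : List A) → HasUnitRescaling as
  unitRescaling as = rescale as (On.wellFounded length <-wellFounded as)
    where
    rescale : (as : List A) → Acc (ℕ._<_ on length) as → HasUnitRescaling as
    rescale [] _ = (λ x → x) , (λ x<y → x<y) , λ ()
    rescale (x ∷ xs) (acc shorter) =
      rescaleLeftmost s-leftmost (rescale (above s (x ∷ xs)) (shorter (above-shorter s∈)))
      where
      s = argmin lo x xs
      s∈ : s ∈ x ∷ xs
      s∈ = [ here , there ]′ (argmin-sel lo x xs)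
      s-leftmost : ∀ {a} → a ∈ x ∷ xs → lo s ≤ lo a
      s-leftmost (here refl) = f[argmin]≤f[⊤] {f = lo} x xs
      s-leftmost (there a∈) = All.lookup (f[argmin]≤f[xs] {f = lo} x xs) a∈

mapVI : (ψ : ℚ → ℚ) → StrictlyIncreasing ψ → VetoInterval → VetoInterval
mapVI ψ ψ-mono a = vi (ψ (l a)) (ψ (v a)) (ψ (r a)) (ψ-mono (l<v a)) (ψ-mono (v<r a))

module _ {ψ : ℚ → ℚ} (ψ-mono : StrictlyIncreasing ψ) where

  VetoAdj-mapVI : ∀ a b → VetoAdj a b ⇔ VetoAdj (mapVI ψ ψ-mono a) (mapVI ψ ψ-mono b)
  VetoAdj-mapVI a b = mk⇔ to from
    where
    cancel = strictlyIncreasing-cancel-< ψ-mono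
    to : VetoAdj a b → VetoAdj (mapVI ψ ψ-mono a) (mapVI ψ ψ-mono b)
    to (inj₁ (p , q , r)) = inj₁ (ψ-mono p , ψ-mono q , ψ-mono r)
    to (inj₂ (p , q , r)) = inj₂ (ψ-mono p , ψ-mono q , ψ-mono r)
    from : VetoAdj (mapVI ψ ψ-mono a) (mapVI ψ ψ-mono b) → VetoAdj a b
    from (inj₁ (p , q , r)) = inj₁ (cancel p , cancel q , cancel r)
    from (inj₂ (p , q , r)) = inj₂ (cancel p , cancel q , cancel r)

  IsVIRep-mapVI : ∀ {G I} → IsVIRep G I → IsVIRep G (mapVI ψ ψ-mono ∘ I)
  IsVIRep-mapVI {I = I} rep a b a≢b = VetoAdj-mapVI (I a) (I b) ⇔-∘ rep a b a≢b

properlyContains⇒length< : ∀ {a b} → ProperlyContains a b → r b - l b < r a - l a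
properlyContains⇒length< (_ , rb≤ra , inj₁ la<lb) = +-mono-≤-< rb≤ra (neg-antimono-< la<lb)
properlyContains⇒length< (la≤lb , _ , inj₂ rb<ra) = +-mono-<-≤ rb<ra (neg-antimono-≤ la≤lb)

unit⇒proper : ∀ {n} {I : Fin n → VetoInterval} → IsUnit I → IsProper I
unit⇒proper {I = I} (_ , length≡) a b a⊃b =
  <-irrefl (trans (length≡ b) (sym (length≡ a))) (properlyContains⇒length< {I a} {I b} a⊃b)

UVI⇒PVI : (G : Graph) → UVI G → PVI G
UVI⇒PVI G (I , rep , unit) = I , rep , unit⇒proper {I = I} unit

¬properlyContains⇒l<⇒r< : ∀ {a b} → ¬ ProperlyContains a b → l a < l b → r a < r b
¬properlyContains⇒l<⇒r< {a} {b} ¬a⊃b la<lb with r a <? r b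
... | yes ra<rb = ra<rb
... | no ra≮rb = contradiction (<⇒≤ la<lb , ≮⇒≥ ra≮rb , inj₁ la<lb) ¬a⊃b

¬properlyContains⇒l≡⇒r≡ : ∀ {a b} → ¬ ProperlyContains a b → ¬ ProperlyContains b a →
                          l a ≡ l b → r a ≡ r b
¬properlyContains⇒l≡⇒r≡ {a} {b} ¬a⊃b ¬b⊃a la≡lb with <-cmp (r a) (r b)
... | tri< ra<rb _ _ = contradiction (≤-reflexive (sym la≡lb) , <⇒≤ ra<rb , inj₂ ra<rb) ¬b⊃a
... | tri≈ _ ra≡rb _ = ra≡rb
... | tri> _ _ rb<ra = contradiction (≤-reflexive la≡lb , <⇒≤ rb<ra , inj₂ rb<ra) ¬a⊃b

proper⇒unitRescaling : ∀ {n} {I : Fin n → VetoInterval} → IsProper I →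
                       ∃[ ψ ] StrictlyIncreasing ψ × ∀ a → ψ (r (I a)) - ψ (l (I a)) ≡ 1ℚ
proper⇒unitRescaling {n} {I} proper =
  let ψ , ψ-mono , ψ-unit = unitRescaling (allFin n) in ψ , ψ-mono , ψ-unit ∘ ∈-allFin
  where
  open UnitRescaling (l ∘ I) (r ∘ I) (λ a → <-trans (l<v (I a)) (v<r (I a)))
    (λ {a} {b} → ¬properlyContains⇒l<⇒r< {I a} {I b} (proper a b))
    (λ {a} {b} → ¬properlyContains⇒l≡⇒r≡ {I a} {I b} (proper a b) (proper b a))

PVI⇒UVI : (G : Graph) → PVI G → UVI G
PVI⇒UVI G (I , rep , proper) =
  let ψ , ψ-mono , ψ-unit = proper⇒unitRescaling {I = I} proper
  in mapVI ψ ψ-mono ∘ I , IsVIRep-mapVI ψ-mono {G} {I} rep , 1ℚ , ψ-unit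

proposition18 : (G : Graph) → PVI G ⇔ UVI G
proposition18 G = mk⇔ (PVI⇒UVI G) (UVI⇒PVI G)
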